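{- For integers $n\ge0$ and $m\in\mathbb{Z}_{(p)}$ one has $b_{m,n}\in\mathbb{Z}$ and $$b_{m,n}=\begin{cases}(-1)^{\bar m}\binom{n}{\bar m}, & 0\le n<p,\\ (-1)^{\bar m}\binom{n}{\bar m}-(-1)^{\bar m}\binom{n}{\bar m+p}, & p\le n<2p,\end{cases}$$ where $0\le\bar m<p$ is the representative of $m\bmod p$. Moreover $p^{\lfloor\frac{n+p-2}{p-1}\rfloor-1}$ divides $b_{m,n}$ for $n\ge1$, and hence $p^j\mid b_{m,n}$ whenever $j(p-1)<n\le(j+1)(p-1)$.
   Context: $p$ is an odd prime, $\mu_p$ the group of $p$-th roots of unity in $\bar{\mathbb{Q}}$. For $m\in\mathbb{Z}_{(p)}$ and $\zeta\in\mu_p$, $\zeta^m$ means $\zeta^{\bar m}$ where $\bar m\in\{0,\dots,p-1\}$ is congruent to $m$ modulo $p$. Define $b_{m,n}=p^{ -1}\sum_{\zeta\in\mu_p}\zeta^m(1-\zeta^{ -1})^n$ for $n\in\mathbb{Z}_{\ge0}$. -}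

module Defs where

open import Data.Nat as ℕ using (ℕ; zero; suc; _∸_; NonZero; NonTrivial)
open import Data.Nat.Primality using (Prime; prime⇒nonTrivial; prime⇒nonZero)
open import Data.Nat.DivMod using (_mod_)
open import Data.Fin using (Fin; toℕ)
open import Data.Integer as ℤ using (ℤ; +_; _+_; _-_; _*_)
open import Relation.Binary.PropositionalEquality using (_≡_)
open import Data.Product using (Σ)
open import Relation.Nullary using (yes; no)

-- We represent elements of ℤ[x]/(x^p − 1) (the group ring ℤ[C_p]) as
-- coefficient functions Fin p → ℤ; ℤ[μ_p] = ℤ[ζ_p] ≅ ℤ[x]/(Φ_p), which is
-- the quotient of ℤ[x]/(x^p−1) by the ℤ-multiples of N = 1 + x + … + x^{p−1}.
-- Hence two representatives are equal in ℤ[ζ_p] iff their difference is a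
-- constant vector (c, c, …, c).  The p-th roots of unity are the images
-- ζ_p^i = x^i, i = 0, …, p−1.

module _ (p : ℕ) .{{_ : NonZero p}} where

  Cyc : Set
  Cyc = Fin p → ℤ

  sumFin : ∀ {k} → (Fin k → ℤ) → ℤ
  sumFin {zero}  f = + 0
  sumFin {suc k} f = f Fin.zero + sumFin (λ i → f (Fin.suc i))

  mono : ℕ → Cyc
  mono k j with toℕ j ℕ.≟ toℕ (k mod p)
  ... | yes _ = + 1
  ... | no  _ = + 0

  const : ℤ → Cyc
  const c j = c * mono 0 j

  _⊕_ : Cyc → Cyc → Cyc
  (f ⊕ g) j = f j + g j

  _⊖_ : Cyc → Cyc → Cyc
  (f ⊖ g) j = f j - g j

  _⊗_ : Cyc → Cyc → Cyc
  (f ⊗ g) k = sumFin (λ i → f i * g ((toℕ k ℕ.+ (p ∸ toℕ i)) mod p))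

  pow : Cyc → ℕ → Cyc
  pow f zero    = const (+ 1)
  pow f (suc n) = f ⊗ pow f n

  _≈_ : Cyc → Cyc → Set
  f ≈ g = Σ ℤ (λ c → ∀ j → f j - g j ≡ c)

  -- Σ_{ζ ∈ μ_p} ζ^{mb} (1 − ζ^{−1})^n, with ζ = ζ_p^i, ζ^{mb} = ζ_p^{i·mb},
  -- ζ^{−1} = ζ_p^{p−i}.
  rootSum : (mb n : ℕ) → Cyc
  rootSum mb n j =
    sumFin (λ (i : Fin p) → (mono (toℕ i ℕ.* mb) ⊗ pow (const (+ 1) ⊖ mono (p ∸ toℕ i)) n) j)

prime⇒pred-nonZero : ∀ {p} → Prime p → NonZero (p ∸ 1)
prime⇒pred-nonZero {p} pr = go (ℕ.nonTrivial⇒n>1 p {{prime⇒nonTrivial pr}})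
  where
  go : ∀ {q} → 1 ℕ.< q → NonZero (q ∸ 1)
  go (ℕ.s≤s (ℕ.s≤s _)) = _

module Submission where

-- Expanding (1 − ζ^{−1})^n binomially and summing over ζ, the
-- orthogonality of characters gives rootSum m̄ n ≈ p · B n m̄, where
--     B n m̄ = Σ_{k ≡ m̄ (mod p)} (−1)^k C(n,k).
-- We encode B with the alternating binomial transform
--     T n h = Σ_k (−1)^k C(n,k) h k,   T (n+1) h = T n h − T n (h ∘ suc).

open import Defs
open import Data.Nat as ℕ using (ℕ; _∸_; _<_; _≤_)
open import Data.Nat.Primality using (Prime; prime⇒nonZero)
open import Data.Nat.Combinatorics using (_C_)
open import Data.Nat.DivMod using (_/_)
open import Data.Integer as ℤ using (ℤ; +_; -1ℤ)
open import Data.Integer.Divisibility as ℤD using ()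
open import Data.Nat.Divisibility as ℕD using ()
open import Data.Rational using (ℚ; ↥_; ↧_; ↧ₙ_)
open import Data.Product using (Σ; _×_)
open import Relation.Binary.PropositionalEquality using (_≡_; _≢_)
open import Relation.Nullary using (¬_)

open import Data.Nat using (zero; suc; z≤n; s≤s; NonZero; _!)
import Data.Nat.Properties as ℕP
open import Data.Nat.DivMod
  using (_%_; _mod_; m≡m%n+[m/n]*n; m<n⇒m%n≡m; m≤n⇒[n∸m]%m≡n%m; m%n<n; m%n%n≡m%n;
         %-distribˡ-+; %-distribˡ-*; [m+kn]%n≡m%n; [m+n]%n≡m%n; m*n%n≡0;
         m/n≡1+[m∸n]/n; m*n/n≡m; /-monoˡ-≤; m/n*n≡m)
open import Data.Nat.Primality using (prime⇒irreducible; prime⇒nonTrivial; euclidsLemma)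
open import Data.Nat.Combinatorics using (nCk+nC[k+1]≡[n+1]C[k+1]; nCk≡n!/k![n-k]!; k![n∸k]!∣n!)
open import Data.Integer using (_+_; _-_; _*_; -_)
import Data.Integer.Properties as ℤP
import Data.Integer.Divisibility.Signed as ℤS
open import Data.Integer.Tactic.RingSolver using (solve-∀)
import Data.Nat.Tactic.RingSolver as ℕS
open import Data.Nat.GeneralisedArithmetic using (iterate)
open import Data.Fin as Fin using (Fin; toℕ; fromℕ<; punchOut)
import Data.Fin.Properties as FinP
open import Relation.Binary.PropositionalEquality
  using (refl; sym; trans; cong; cong₂; subst; subst₂; module ≡-Reasoning)
open import Relation.Nullary using (yes; no)
open import Data.Product using (_,_; ∃)
open import Data.Sum using (inj₁; inj₂)
open import Data.Empty using (⊥-elim)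

-- 1. Deltas, finite sums and the alternating binomial transform

δ : ℕ → ℕ → ℤ
δ a b with a ℕ.≟ b
... | yes _ = + 1
... | no  _ = + 0

δ-≡ : ∀ {a b} → a ≡ b → δ a b ≡ + 1
δ-≡ {a} {b} a≡b with a ℕ.≟ b
... | yes _   = refl
... | no  a≢b = ⊥-elim (a≢b a≡b)

δ-≢ : ∀ {a b} → a ≢ b → δ a b ≡ + 0
δ-≢ {a} {b} a≢b with a ℕ.≟ b
... | yes a≡b = ⊥-elim (a≢b a≡b)
... | no  _   = refl

δ-cong : ∀ {a b c d} → (a ≡ b → c ≡ d) → (c ≡ d → a ≡ b) → δ a b ≡ δ c d
δ-cong {a} {b} to from with a ℕ.≟ b
... | yes a≡b = sym (δ-≡ (to a≡b))
... | no  a≢b = sym (δ-≢ (λ c≡d → a≢b (from c≡d)))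

δ-sym : ∀ a b → δ a b ≡ δ b a
δ-sym a b = δ-cong sym sym

δ-suc : ∀ a b → δ (suc a) (suc b) ≡ δ a b
δ-suc a b = δ-cong ℕP.suc-injective (cong suc)

∑ : ℕ → (ℕ → ℤ) → ℤ
∑ zero    F = + 0
∑ (suc k) F = F 0 + ∑ k (λ i → F (suc i))

∑-cong : ∀ k {F G : ℕ → ℤ} → (∀ i → i < k → F i ≡ G i) → ∑ k F ≡ ∑ k G
∑-cong zero    F≡G = refl
∑-cong (suc k) F≡G = cong₂ _+_ (F≡G 0 (s≤s z≤n)) (∑-cong k (λ i i<k → F≡G (suc i) (s≤s i<k)))

∑-zero : ∀ k → ∑ k (λ _ → + 0) ≡ + 0
∑-zero zero    = refl
∑-zero (suc k) = trans (ℤP.+-identityˡ _) (∑-zero k)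

∑-const : ∀ k c → ∑ k (λ _ → c) ≡ + k * c
∑-const zero    c = sym (ℤP.*-zeroˡ c)
∑-const (suc k) c = trans (cong (_+_ c) (∑-const k c)) (alg c (+ k))
  where
  alg : ∀ c k → c + k * c ≡ (+ 1 + k) * c
  alg = solve-∀

∑-- : ∀ k (F G : ℕ → ℤ) → ∑ k (λ i → F i - G i) ≡ ∑ k F - ∑ k G
∑-- zero    F G = refl
∑-- (suc k) F G = trans (cong (_+_ (F 0 - G 0)) (∑-- k _ _)) (alg (F 0) (G 0) _ _)
  where
  alg : ∀ a b c d → a - b + (c - d) ≡ a + c - (b + d)
  alg = solve-∀

∑-δ : ∀ k r (H : ℕ → ℤ) → r < k → ∑ k (λ i → δ i r * H i) ≡ H r
∑-δ (suc k) zero H _ = begin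
    δ 0 0 * H 0 + ∑ k (λ i → δ (suc i) 0 * H (suc i))
      ≡⟨ cong₂ _+_ (cong (_* H 0) (δ-≡ {0} {0} refl))
                   (trans (∑-cong k (λ i _ → cong (_* H (suc i)) (δ-≢ {suc i} {0} λ ()))) (∑-zero k)) ⟩
    + 1 * H 0 + + 0
      ≡⟨ trans (ℤP.+-identityʳ _) (ℤP.*-identityˡ _) ⟩
    H 0 ∎
  where open ≡-Reasoning
∑-δ (suc k) (suc r) H (s≤s r<k) = begin
    δ 0 (suc r) * H 0 + ∑ k (λ i → δ (suc i) (suc r) * H (suc i))
      ≡⟨ cong₂ _+_ (cong (_* H 0) (δ-≢ {0} {suc r} λ ())) (∑-cong k (λ i _ → cong (_* H (suc i)) (δ-suc i r))) ⟩
    + 0 + ∑ k (λ i → δ i r * H (suc i))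
      ≡⟨ trans (ℤP.+-identityˡ _) (∑-δ k r (λ i → H (suc i)) r<k) ⟩
    H (suc r) ∎
  where open ≡-Reasoning

∑-∣ : ∀ k d F → (∀ i → i < k → d ℤS.∣ F i) → d ℤS.∣ ∑ k F
∑-∣ zero    d F _   = ℤS.divides (+ 0) (sym (ℤP.*-zeroˡ d))
∑-∣ (suc k) d F d∣F = ℤS.∣m∣n⇒∣m+n (d∣F 0 (s≤s z≤n)) (∑-∣ k d _ (λ i i<k → d∣F (suc i) (s≤s i<k)))

∑-telescope : ∀ k (g : ℕ → ℤ) → ∑ k (λ i → g i - g (suc i)) ≡ g 0 - g k
∑-telescope zero    g = sym (ℤP.+-inverseʳ (g 0))
∑-telescope (suc k) g = trans (cong (_+_ (g 0 - g 1)) (∑-telescope k (λ i → g (suc i)))) (alg (g 0) (g 1) (g (suc k)))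
  where
  alg : ∀ a b c → a - b + (b - c) ≡ a - c
  alg = solve-∀

-- The alternating binomial transform: T n h = Σ_{k ≤ n} (−1)^k C(n,k) h k.
T : ℕ → (ℕ → ℤ) → ℤ
T zero    h = h 0
T (suc n) h = T n h - T n (λ k → h (suc k))

T-cong : ∀ n {h g : ℕ → ℤ} → (∀ k → k ≤ n → h k ≡ g k) → T n h ≡ T n g
T-cong zero    h≡g = h≡g 0 z≤n
T-cong (suc n) h≡g = cong₂ _-_ (T-cong n (λ k k≤n → h≡g k (ℕP.m≤n⇒m≤1+n k≤n)))
                               (T-cong n (λ k k≤n → h≡g (suc k) (s≤s k≤n)))

T-zero : ∀ n → T n (λ _ → + 0) ≡ + 0
T-zero zero    = refl
T-zero (suc n) = cong₂ _-_ (T-zero n) (T-zero n)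

T-+ : ∀ n (h g : ℕ → ℤ) → T n (λ k → h k + g k) ≡ T n h + T n g
T-+ zero    h g = refl
T-+ (suc n) h g = trans (cong₂ _-_ (T-+ n h g) (T-+ n _ _)) (alg (T n h) (T n g) _ _)
  where
  alg : ∀ a b c d → a + b - (c + d) ≡ a - c + (b - d)
  alg = solve-∀

T-scale : ∀ n c (h : ℕ → ℤ) → T n (λ k → c * h k) ≡ c * T n h
T-scale zero    c h = refl
T-scale (suc n) c h = trans (cong₂ _-_ (T-scale n c h) (T-scale n c _)) (alg c (T n h) _)
  where
  alg : ∀ c a b → c * a - c * b ≡ c * (a - b)
  alg = solve-∀

T-∑ : ∀ n q (H : ℕ → ℕ → ℤ) → T n (λ k → ∑ q (λ i → H i k)) ≡ ∑ q (λ i → T n (H i))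
T-∑ n zero    H = T-zero n
T-∑ n (suc q) H = trans (T-+ n (H 0) _) (cong (_+_ (T n (H 0))) (T-∑ n q (λ i → H (suc i))))

sgn : ℕ → ℤ
sgn k = -1ℤ ℤ.^ k

T-δ : ∀ n a → T n (λ k → δ k a) ≡ sgn a * + (n C a)
T-δ zero    zero    = refl
T-δ zero    (suc a) = trans (δ-≢ {0} {suc a} λ ()) (sym (ℤP.*-zeroʳ (sgn (suc a))))
T-δ (suc n) zero    = trans (cong₂ _-_ (T-δ n zero) (trans (T-cong n (λ k _ → δ-≢ {suc k} {0} λ ())) (T-zero n)))
                            (ℤP.+-identityʳ _)
T-δ (suc n) (suc a) = begin
    T n (λ k → δ k (suc a)) - T n (λ k → δ (suc k) (suc a))
      ≡⟨ cong₂ _-_ (T-δ n (suc a)) (trans (T-cong n (λ k _ → δ-suc k a)) (T-δ n a)) ⟩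
    (-1ℤ * sgn a) * + (n C suc a) - sgn a * + (n C a)
      ≡⟨ alg (sgn a) _ _ ⟩
    (-1ℤ * sgn a) * (+ (n C a) + + (n C suc a))
      ≡⟨ cong ((-1ℤ * sgn a) *_) (trans (sym (ℤP.pos-+ (n C a) _)) (cong +_ (nCk+nC[k+1]≡[n+1]C[k+1] n a))) ⟩
    (-1ℤ * sgn a) * + (suc n C suc a) ∎
  where
  open ≡-Reasoning
  alg : ∀ s x y → (-1ℤ * s) * y - s * x ≡ (-1ℤ * s) * (x + y)
  alg = solve-∀

T-expand : ∀ n h → T n h ≡ ∑ (suc n) (λ l → h l * (sgn l * + (n C l)))
T-expand n h = begin
    T n h
      ≡⟨ T-cong n (λ k k≤n → sym (∑-δ (suc n) k h (s≤s k≤n))) ⟩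
    T n (λ k → ∑ (suc n) (λ l → δ l k * h l))
      ≡⟨ T-∑ n (suc n) (λ l k → δ l k * h l) ⟩
    ∑ (suc n) (λ l → T n (λ k → δ l k * h l))
      ≡⟨ ∑-cong (suc n) (λ l _ → T-cong n (λ k _ → trans (ℤP.*-comm (δ l k) (h l)) (cong (h l *_) (δ-sym l k)))) ⟩
    ∑ (suc n) (λ l → T n (λ k → h l * δ k l))
      ≡⟨ ∑-cong (suc n) (λ l _ → trans (T-scale n (h l) (λ k → δ k l)) (cong (h l *_) (T-δ n l))) ⟩
    ∑ (suc n) (λ l → h l * (sgn l * + (n C l))) ∎
  where open ≡-Reasoning

-- 2. Arithmetic modulo p

fin-injection-surjective : ∀ n (f : Fin n → Fin n) → (∀ i i' → f i ≡ f i' → i ≡ i') →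
  ∀ j → ∃ λ i → f i ≡ j
fin-injection-surjective n f inj j with FinP.any? (λ i → f i FinP.≟ j)
... | yes hit = hit
fin-injection-surjective (suc n) f inj j | no miss
  with FinP.pigeonhole (ℕP.n<1+n n) (λ i → punchOut {i = j} {j = f i} (λ e → miss (i , sym e)))
... | i , i' , i<i' , same = ⊥-elim (FinP.<⇒≢ i<i' (inj i i'
        (FinP.punchOut-injective {i = j} (λ e → miss (i , sym e)) (λ e → miss (i' , sym e)) same)))

-- An injective map of [0,p) into itself hits every point of [0,p) exactly
-- once, so the corresponding sum of deltas is 1.
injection-count : ∀ p (φ : ℕ → ℕ) → (∀ i → i < p → φ i < p) →
  (∀ i₁ i₂ → i₁ < p → i₂ < p → φ i₁ ≡ φ i₂ → i₁ ≡ i₂) →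
  ∀ j → j < p → ∑ p (λ i → δ j (φ i)) ≡ + 1
injection-count p φ φ<p φ-inj j j<p with fin-injection-surjective p f f-inj (fromℕ< j<p)
  where
  f : Fin p → Fin p
  f i = fromℕ< (φ<p (toℕ i) (FinP.toℕ<n i))
  f-inj : ∀ i i' → f i ≡ f i' → i ≡ i'
  f-inj i i' e = FinP.toℕ-injective (φ-inj _ _ (FinP.toℕ<n i) (FinP.toℕ<n i')
    (trans (sym (FinP.toℕ-fromℕ< _)) (trans (cong toℕ e) (FinP.toℕ-fromℕ< _))))
... | i₀ , e = trans
  (∑-cong p (λ i i<p → trans (δ-cong (λ j≡φi → φ-inj i (toℕ i₀) i<p (FinP.toℕ<n i₀) (trans (sym j≡φi) (sym φi₀≡j)))
                                      (λ i≡i₀ → trans (sym φi₀≡j) (cong φ (sym i≡i₀))))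
                             (sym (ℤP.*-identityʳ _))))
  (∑-δ p (toℕ i₀) (λ _ → + 1) (FinP.toℕ<n i₀))
  where
  φi₀≡j : φ (toℕ i₀) ≡ j
  φi₀≡j = trans (sym (FinP.toℕ-fromℕ< _)) (trans (cong toℕ e) (FinP.toℕ-fromℕ< _))

<-∣-diff⇒≡ : ∀ {p l₁ l₂} → l₁ < p → l₂ < p → p ℕD.∣ ℤ.∣ + l₁ - + l₂ ∣ → l₁ ≡ l₂
<-∣-diff⇒≡ {p} {l₁} {l₂} l₁<p l₂<p p∣d with ℤ.∣ + l₁ - + l₂ ∣ in eq
... | zero  = ℤP.+-injective (ℤP.i-j≡0⇒i≡j (+ l₁) (+ l₂) (ℤP.∣i∣≡0⇒i≡0 eq))
... | suc d = ⊥-elim (ℕD.>⇒∤ d<p p∣d)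
  where
  d<p : suc d < p
  d<p = subst (_< p) eq (ℕP.≤-<-trans
    (subst (ℕ._≤ l₁ ℕ.⊔ l₂) (cong ℤ.∣_∣ (sym (ℤP.m-n≡m⊖n l₁ l₂))) (ℤP.∣m⊝n∣≤m⊔n l₁ l₂))
    (ℕP.⊔-pres-<m l₁<p l₂<p))

module Mod (p : ℕ) .{{_ : NonZero p}} where

  pos-divmod : ∀ x → + x ≡ + (x % p) + + (x / p) * + p
  pos-divmod x = trans (cong +_ (m≡m%n+[m/n]*n x p))
    (trans (ℤP.pos-+ (x % p) _) (cong (_+_ (+ (x % p))) (ℤP.pos-* (x / p) p)))

  %-≡⇒∣- : ∀ x y → x % p ≡ y % p → p ℕD.∣ ℤ.∣ + x - + y ∣
  %-≡⇒∣- x y x≡y = ℕD.divides ℤ.∣ + (x / p) - + (y / p) ∣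
    (trans (cong ℤ.∣_∣ diff) (ℤP.abs-* (+ (x / p) - + (y / p)) (+ p)))
    where
    alg : ∀ r a b P → r + a * P - (r + b * P) ≡ (a - b) * P
    alg = solve-∀
    diff : + x - + y ≡ (+ (x / p) - + (y / p)) * + p
    diff = trans (cong₂ _-_ (pos-divmod x) (trans (pos-divmod y) (cong (λ r → + r + + (y / p) * + p) (sym x≡y))))
                 (alg (+ (x % p)) (+ (x / p)) (+ (y / p)) (+ p))

  ∣-⇒%-≡ : ∀ x y → p ℕD.∣ ℤ.∣ + x - + y ∣ → x % p ≡ y % p
  ∣-⇒%-≡ x y p∣x-y = <-∣-diff⇒≡ (m%n<n x p) (m%n<n y p) (ℤS.∣⇒∣ᵤ (subst (+ p ℤS.∣_) diff
    (ℤS.∣m∣n⇒∣m-n (ℤS.∣ᵤ⇒∣ {i = + x - + y} p∣x-y) (ℤS.∣n⇒∣m*n (+ (x / p) - + (y / p)) ℤS.∣-refl))))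
    where
    alg : ∀ r s a b P → r + a * P - (s + b * P) - (a - b) * P ≡ r - s
    alg = solve-∀
    diff : + x - + y - (+ (x / p) - + (y / p)) * + p ≡ + (x % p) - + (y % p)
    diff = trans (cong (λ z → z - (+ (x / p) - + (y / p)) * + p) (cong₂ _-_ (pos-divmod x) (pos-divmod y)))
                 (alg (+ (x % p)) (+ (y % p)) (+ (x / p)) (+ (y / p)) (+ p))

  affine-injective : Prime p → (ψ : ℕ → ℕ) (c : ℤ) → ¬ (p ℕD.∣ ℤ.∣ c ∣) →
    (∀ l₁ l₂ → l₁ < p → l₂ < p → + ψ l₁ - + ψ l₂ ≡ (+ l₁ - + l₂) * c) →
    ∀ l₁ l₂ → l₁ < p → l₂ < p → ψ l₁ % p ≡ ψ l₂ % p → l₁ ≡ l₂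
  affine-injective pr ψ c p∤c diff l₁ l₂ l₁<p l₂<p ψ≡ψ
    with euclidsLemma ℤ.∣ + l₁ - + l₂ ∣ ℤ.∣ c ∣ pr
           (subst (p ℕD.∣_) (trans (cong ℤ.∣_∣ (diff l₁ l₂ l₁<p l₂<p)) (ℤP.abs-* (+ l₁ - + l₂) c)) (%-≡⇒∣- (ψ l₁) (ψ l₂) ψ≡ψ))
  ... | inj₁ p∣l₁-l₂ = <-∣-diff⇒≡ l₁<p l₂<p p∣l₁-l₂
  ... | inj₂ p∣c     = ⊥-elim (p∤c p∣c)

  %-absorbˡ : ∀ m n → (m % p ℕ.+ n) % p ≡ (m ℕ.+ n) % p
  %-absorbˡ m n = trans (%-distribˡ-+ (m % p) n p)
    (trans (cong (λ r → (r ℕ.+ n % p) % p) (m%n%n≡m%n m p)) (sym (%-distribˡ-+ m n p)))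

  %-absorbʳ : ∀ m n → (m ℕ.+ n % p) % p ≡ (m ℕ.+ n) % p
  %-absorbʳ m n = trans (cong (_% p) (ℕP.+-comm m (n % p)))
    (trans (%-absorbˡ n m) (cong (_% p) (ℕP.+-comm n m)))

  neg : ℕ → ℕ
  neg a = p ∸ a % p

  neg-cancel : ∀ y a → (y ℕ.+ (a ℕ.+ neg a)) % p ≡ y % p
  neg-cancel y a = trans (cong (λ z → (y ℕ.+ z) % p) a+neg-a) ([m+kn]%n≡m%n y (suc (a / p)) p)
    where
    open ≡-Reasoning
    a+neg-a : a ℕ.+ neg a ≡ suc (a / p) ℕ.* p
    a+neg-a = begin
      a ℕ.+ neg a                           ≡⟨ cong (ℕ._+ neg a) (m≡m%n+[m/n]*n a p) ⟩
      a % p ℕ.+ a / p ℕ.* p ℕ.+ neg a       ≡⟨ ℕP.+-assoc (a % p) _ (neg a) ⟩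
      a % p ℕ.+ (a / p ℕ.* p ℕ.+ neg a)     ≡⟨ cong (a % p ℕ.+_) (ℕP.+-comm (a / p ℕ.* p) (neg a)) ⟩
      a % p ℕ.+ (neg a ℕ.+ a / p ℕ.* p)     ≡⟨ sym (ℕP.+-assoc (a % p) (neg a) _) ⟩
      a % p ℕ.+ neg a ℕ.+ a / p ℕ.* p       ≡⟨ cong (ℕ._+ a / p ℕ.* p) (ℕP.m+[n∸m]≡n (ℕP.<⇒≤ (m%n<n a p))) ⟩
      suc (a / p) ℕ.* p                     ∎

  shift-δ : ∀ x a t → t < p → δ t ((x ℕ.+ a) % p) ≡ δ ((t ℕ.+ neg a) % p) (x % p)
  shift-δ x a t t<p = δ-cong forward backward
    where
    open ≡-Reasoning
    forward : t ≡ (x ℕ.+ a) % p → (t ℕ.+ neg a) % p ≡ x % p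
    forward t≡ = begin
      (t ℕ.+ neg a) % p                     ≡⟨ cong (λ z → (z ℕ.+ neg a) % p) t≡ ⟩
      ((x ℕ.+ a) % p ℕ.+ neg a) % p         ≡⟨ %-absorbˡ (x ℕ.+ a) (neg a) ⟩
      (x ℕ.+ a ℕ.+ neg a) % p               ≡⟨ cong (_% p) (ℕP.+-assoc x a (neg a)) ⟩
      (x ℕ.+ (a ℕ.+ neg a)) % p             ≡⟨ neg-cancel x a ⟩
      x % p                                 ∎
    backward : (t ℕ.+ neg a) % p ≡ x % p → t ≡ (x ℕ.+ a) % p
    backward ≡x = sym (begin
      (x ℕ.+ a) % p                         ≡⟨ sym (%-absorbˡ x a) ⟩
      (x % p ℕ.+ a) % p                     ≡⟨ cong (λ z → (z ℕ.+ a) % p) (sym ≡x) ⟩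
      ((t ℕ.+ neg a) % p ℕ.+ a) % p         ≡⟨ %-absorbˡ (t ℕ.+ neg a) a ⟩
      (t ℕ.+ neg a ℕ.+ a) % p               ≡⟨ cong (_% p) (trans (ℕP.+-assoc t (neg a) a) (cong (t ℕ.+_) (ℕP.+-comm (neg a) a))) ⟩
      (t ℕ.+ (a ℕ.+ neg a)) % p             ≡⟨ neg-cancel t a ⟩
      t % p                                 ≡⟨ m<n⇒m%n≡m t<p ⟩
      t                                     ∎)

-- 3. The root sum in the model ℤ[x]/(x^p − 1)

module Model (p : ℕ) .{{_ : NonZero p}} where
  open Mod p

  0%p : 0 % p ≡ 0
  0%p = m<n⇒m%n≡m (ℕ.>-nonZero⁻¹ p)

  mono-δ : ∀ k j → mono p k j ≡ δ (toℕ j) (k % p)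
  mono-δ k j = trans (mono≡δ-mod k j) (cong (δ (toℕ j)) (FinP.toℕ-fromℕ< (m%n<n k p)))
    where
    mono≡δ-mod : ∀ k j → mono p k j ≡ δ (toℕ j) (toℕ (k mod p))
    mono≡δ-mod k j with toℕ j ℕ.≟ toℕ (k mod p)
    ... | yes _ = refl
    ... | no  _ = refl

  sumFin-∑ : ∀ {k} (f : Fin k → ℤ) (G : ℕ → ℤ) → (∀ i → f i ≡ G (toℕ i)) → sumFin p f ≡ ∑ k G
  sumFin-∑ {zero}  f G f≡G = refl
  sumFin-∑ {suc k} f G f≡G = cong₂ _+_ (f≡G Fin.zero) (sumFin-∑ _ (λ i → G (suc i)) (λ i → f≡G (Fin.suc i)))

  mono-⊗ : ∀ e (g : Cyc p) (G : ℕ → ℤ) → (∀ t → g t ≡ G (toℕ t)) →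
    ∀ j → _⊗_ p (mono p e) g j ≡ G ((toℕ j ℕ.+ neg e) % p)
  mono-⊗ e g G g≡G j = trans
    (sumFin-∑ _ (λ i → δ i (e % p) * G ((toℕ j ℕ.+ (p ∸ i)) % p))
      (λ i → cong₂ _*_ (mono-δ e i) (trans (g≡G _) (cong G (FinP.toℕ-fromℕ< (m%n<n _ p))))))
    (∑-δ p (e % p) (λ i → G ((toℕ j ℕ.+ (p ∸ i)) % p)) (m%n<n e p))

  pow-1-mono : ∀ a n j →
    pow p (_⊖_ p (const p (+ 1)) (mono p a)) n j ≡ T n (λ k → δ (toℕ j) ((a ℕ.* k) % p))
  pow-1-mono a zero j = trans (ℤP.*-identityˡ _)
    (trans (mono-δ 0 j) (cong (λ z → δ (toℕ j) (z % p)) (sym (ℕP.*-zeroʳ a))))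
  pow-1-mono a (suc n) j = begin
      sumFin p (λ i → (const p (+ 1) i - mono p a i) * pow p _ n ((toℕ j ℕ.+ (p ∸ toℕ i)) mod p))
        ≡⟨ sumFin-∑ _ (λ i → (δ i (0 % p) - δ i (a % p)) * H i)
             (λ i → cong₂ _*_ (cong₂ _-_ (trans (ℤP.*-identityˡ _) (mono-δ 0 i)) (mono-δ a i))
                              (trans (pow-1-mono a n _) (cong G (FinP.toℕ-fromℕ< (m%n<n _ p))))) ⟩
      ∑ p (λ i → (δ i (0 % p) - δ i (a % p)) * H i)
        ≡⟨ ∑-cong p (λ i _ → distribʳ-- (δ i (0 % p)) (δ i (a % p)) (H i)) ⟩
      ∑ p (λ i → δ i (0 % p) * H i - δ i (a % p) * H i)
        ≡⟨ ∑-- p _ _ ⟩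
      ∑ p (λ i → δ i (0 % p) * H i) - ∑ p (λ i → δ i (a % p) * H i)
        ≡⟨ cong₂ _-_ (∑-δ p (0 % p) H (m%n<n 0 p)) (∑-δ p (a % p) H (m%n<n a p)) ⟩
      H (0 % p) - H (a % p)
        ≡⟨ cong (_- H (a % p)) (cong G (trans (cong (λ z → (toℕ j ℕ.+ (p ∸ z)) % p) 0%p)
             (trans ([m+n]%n≡m%n (toℕ j) p) (m<n⇒m%n≡m (FinP.toℕ<n j))))) ⟩
      G (toℕ j) - H (a % p)
        ≡⟨ cong (_-_ (G (toℕ j))) (T-cong n (λ k _ → sym (trans
             (cong (λ z → δ (toℕ j) (z % p)) (trans (ℕP.*-suc a k) (ℕP.+-comm a (a ℕ.* k))))
             (shift-δ (a ℕ.* k) a (toℕ j) (FinP.toℕ<n j))))) ⟩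
      T (suc n) (λ k → δ (toℕ j) ((a ℕ.* k) % p)) ∎
    where
    open ≡-Reasoning
    G : ℕ → ℤ
    G t = T n (λ k → δ t ((a ℕ.* k) % p))
    H : ℕ → ℤ
    H i = G ((toℕ j ℕ.+ (p ∸ i)) % p)
    distribʳ-- : ∀ a b h → (a - b) * h ≡ a * h - b * h
    distribʳ-- = solve-∀

  -- The value of b_{m,n}:  B n m̄ = Σ_{k ≡ m̄ (mod p)} (−1)^k C(n,k).
  B : ℕ → ℕ → ℤ
  B n mb = T n (λ k → δ (k % p) mb)

  -- ψ mb k i is the exponent of x in ζ^{m̄} (ζ^{−1})^k for ζ = x^i.
  ψ : ℕ → ℕ → ℕ → ℕ
  ψ mb k i = (p ∸ i) ℕ.* k ℕ.+ i ℕ.* mb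

  ψ-degenerate : ∀ mb k i → k % p ≡ mb → i ≤ p → ψ mb k i % p ≡ 0
  ψ-degenerate mb k i k≡mb i≤p = begin
      ((p ∸ i) ℕ.* k ℕ.+ i ℕ.* mb) % p
        ≡⟨ cong (λ z → ((p ∸ i) ℕ.* k ℕ.+ i ℕ.* z) % p) (sym k≡mb) ⟩
      ((p ∸ i) ℕ.* k ℕ.+ i ℕ.* (k % p)) % p
        ≡⟨ sym (%-absorbʳ ((p ∸ i) ℕ.* k) (i ℕ.* (k % p))) ⟩
      ((p ∸ i) ℕ.* k ℕ.+ (i ℕ.* (k % p)) % p) % p
        ≡⟨ cong (λ z → ((p ∸ i) ℕ.* k ℕ.+ z) % p) ik≡ik ⟩
      ((p ∸ i) ℕ.* k ℕ.+ (i ℕ.* k) % p) % p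
        ≡⟨ %-absorbʳ ((p ∸ i) ℕ.* k) (i ℕ.* k) ⟩
      ((p ∸ i) ℕ.* k ℕ.+ i ℕ.* k) % p
        ≡⟨ cong (_% p) (trans (sym (ℕP.*-distribʳ-+ k (p ∸ i) i)) (cong (ℕ._* k) (ℕP.m∸n+n≡m i≤p))) ⟩
      (p ℕ.* k) % p
        ≡⟨ trans (cong (_% p) (ℕP.*-comm p k)) (m*n%n≡0 k p) ⟩
      0 ∎
    where
    open ≡-Reasoning
    ik≡ik : (i ℕ.* (k % p)) % p ≡ (i ℕ.* k) % p
    ik≡ik = trans (%-distribˡ-* i (k % p) p)
      (trans (cong (λ z → ((i % p) ℕ.* z) % p) (m%n%n≡m%n k p)) (sym (%-distribˡ-* i k p)))

  ψ-diff : ∀ mb k l₁ l₂ → l₁ < p → l₂ < p → + ψ mb k l₁ - + ψ mb k l₂ ≡ (+ l₁ - + l₂) * (+ mb - + k)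
  ψ-diff mb k l₁ l₂ l₁<p l₂<p =
    trans (cong₂ _-_ (ψ-in-ℤ l₁ (ℕP.<⇒≤ l₁<p)) (ψ-in-ℤ l₂ (ℕP.<⇒≤ l₂<p))) (alg (+ p) (+ k) (+ mb) (+ l₁) (+ l₂))
    where
    ψ-in-ℤ : ∀ i → i ≤ p → + ψ mb k i ≡ (+ p - + i) * + k + + i * + mb
    ψ-in-ℤ i i≤p = trans (ℤP.pos-+ ((p ∸ i) ℕ.* k) (i ℕ.* mb))
      (cong₂ _+_ (trans (ℤP.pos-* (p ∸ i) k) (cong (_* + k) (trans (sym (ℤP.⊖-≥ i≤p)) (sym (ℤP.m-n≡m⊖n p i)))))
                 (ℤP.pos-* i mb))
    alg : ∀ P K M a b → ((P - a) * K + a * M) - ((P - b) * K + b * M) ≡ (a - b) * (M - K)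
    alg = solve-∀

  orthogonality : Prime p → ∀ mb j → mb < p → j < p → ∀ k →
    ∑ p (λ i → δ j (ψ mb k i % p)) ≡ (+ p * δ j 0) * δ (k % p) mb + (+ 1 - δ (k % p) mb)
  orthogonality pr mb j mb<p j<p k with k % p ℕ.≟ mb
  ... | yes k≡mb = trans (∑-cong p (λ i i<p → cong (δ j) (ψ-degenerate mb k i k≡mb (ℕP.<⇒≤ i<p))))
    (trans (∑-const p (δ j 0)) (trans (sym (ℤP.*-identityʳ _)) (sym (ℤP.+-identityʳ _))))
  ... | no k≢mb = trans
    (injection-count p (λ i → ψ mb k i % p) (λ i _ → m%n<n _ p)
      (affine-injective pr (ψ mb k) (+ mb - + k) p∤mb-k (ψ-diff mb k)) j j<p)
    (sym (trans (cong (_+ + 1) (ℤP.*-zeroʳ (+ p * δ j 0))) (ℤP.+-identityˡ _)))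
    where
    p∤mb-k : ¬ (p ℕD.∣ ℤ.∣ + mb - + k ∣)
    p∤mb-k p∣mb-k = k≢mb (sym (trans (sym (m<n⇒m%n≡m mb<p)) (∣-⇒%-≡ mb k p∣mb-k)))

  -- The root sum differs from p · B n m̄ by a constant, i.e. they are equal
  -- in ℤ[ζ_p].
  rootSum-formula : Prime p → ∀ mb n → mb < p → ∀ (j : Fin p) →
    rootSum p mb n j - const p (+ p * B n mb) j ≡ T n (λ k → + 1 - δ (k % p) mb)
  rootSum-formula pr mb n mb<p j = begin
      rootSum p mb n j - const p (+ p * b) j
        ≡⟨ cong₂ _-_ expand (cong (+ p * b *_) (trans (mono-δ 0 j) (cong (δ (toℕ j)) 0%p))) ⟩
      ∑ p (λ i → T n (λ k → δ ((toℕ j ℕ.+ neg (i ℕ.* mb)) % p) (((p ∸ i) ℕ.* k) % p))) - + p * b * d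
        ≡⟨ cong (_- + p * b * d) (∑-cong p (λ i _ → T-cong n (λ k _ →
             sym (shift-δ ((p ∸ i) ℕ.* k) (i ℕ.* mb) (toℕ j) (FinP.toℕ<n j))))) ⟩
      ∑ p (λ i → T n (λ k → δ (toℕ j) (ψ mb k i % p))) - + p * b * d
        ≡⟨ cong (_- + p * b * d) (sym (T-∑ n p (λ i k → δ (toℕ j) (ψ mb k i % p)))) ⟩
      T n (λ k → ∑ p (λ i → δ (toℕ j) (ψ mb k i % p))) - + p * b * d
        ≡⟨ cong (_- + p * b * d) (T-cong n (λ k _ → orthogonality pr mb (toℕ j) mb<p (FinP.toℕ<n j) k)) ⟩
      T n (λ k → + p * d * δ (k % p) mb + (+ 1 - δ (k % p) mb)) - + p * b * d
        ≡⟨ cong (_- + p * b * d) (trans (T-+ n _ _) (cong (_+ c) (T-scale n (+ p * d) _))) ⟩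
      + p * d * b + c - + p * b * d
        ≡⟨ alg (+ p) d b c ⟩
      c ∎
    where
    open ≡-Reasoning
    b = B n mb
    c = T n (λ k → + 1 - δ (k % p) mb)
    d = δ (toℕ j) 0
    alg : ∀ P d b c → P * d * b + c - P * b * d ≡ c
    alg = solve-∀
    expand : rootSum p mb n j ≡ ∑ p (λ i → T n (λ k → δ ((toℕ j ℕ.+ neg (i ℕ.* mb)) % p) (((p ∸ i) ℕ.* k) % p)))
    expand = sumFin-∑ {p} _ (λ i → T n (λ k → δ ((toℕ j ℕ.+ neg (i ℕ.* mb)) % p) (((p ∸ i) ℕ.* k) % p)))
      (λ i → mono-⊗ (toℕ i ℕ.* mb) _ (λ t → T n (λ k → δ t (((p ∸ toℕ i) ℕ.* k) % p)))
                    (pow-1-mono (p ∸ toℕ i) n) j)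

-- 4. Closed forms of B n m̄ for n < 2p

sgn-even : ∀ q → sgn (q ℕ.* 2) ≡ + 1
sgn-even zero    = refl
sgn-even (suc q) = trans (ℤP.-1*i≡-i _) (trans (cong -_ (ℤP.-1*i≡-i _))
  (trans (ℤP.neg-involutive _) (sgn-even q)))

sgn-odd-prime : ∀ {p} → Prime p → p ≢ 2 → sgn p ≡ -1ℤ
sgn-odd-prime {p} pr p≢2 with p % 2 | m≡m%n+[m/n]*n p 2 | m%n<n p 2
... | 1 | p≡1+2q | _ = trans (cong sgn p≡1+2q) (trans (ℤP.-1*i≡-i _) (cong -_ (sgn-even (p / 2))))
... | 0 | p≡2q | _ with prime⇒irreducible pr (ℕD.divides (p / 2) p≡2q)
...   | inj₁ ()
...   | inj₂ 2≡p = ⊥-elim (p≢2 (sym 2≡p))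
sgn-odd-prime pr p≢2 | suc (suc _) | _ | s≤s (s≤s ())

-- The closed forms hold for every modulus; only B-middle needs p odd.
module ClosedForms (p : ℕ) .{{_ : NonZero p}} where
  open Model p

  -- For n < p at most one k ≤ n lies in the class of m̄.
  B-small : ∀ n mb → n < p → B n mb ≡ sgn mb * + (n C mb)
  B-small n mb n<p = trans (T-cong n (λ k k≤n → cong (λ r → δ r mb) (m<n⇒m%n≡m (ℕP.≤-<-trans k≤n n<p))))
                           (T-δ n mb)

  δ-mod-two-periods : ∀ k mb → mb < p → k < 2 ℕ.* p → δ (k % p) mb ≡ δ k mb + δ k (mb ℕ.+ p)
  δ-mod-two-periods k mb mb<p k<2p with k ℕ.<? p
  ... | yes k<p = begin
      δ (k % p) mb                 ≡⟨ cong (λ r → δ r mb) (m<n⇒m%n≡m k<p) ⟩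
      δ k mb                       ≡⟨ sym (ℤP.+-identityʳ _) ⟩
      δ k mb + + 0                 ≡⟨ cong (_+_ (δ k mb)) (sym (δ-≢ (λ k≡ → ℕP.<-irrefl k≡ (ℕP.<-≤-trans k<p (ℕP.m≤n+m p mb))))) ⟩
      δ k mb + δ k (mb ℕ.+ p)      ∎
    where open ≡-Reasoning
  ... | no k≮p = begin
      δ (k % p) mb                 ≡⟨ cong (λ r → δ r mb) (trans (sym (m≤n⇒[n∸m]%m≡n%m p≤k)) (m<n⇒m%n≡m k-p<p)) ⟩
      δ (k ∸ p) mb                 ≡⟨ δ-cong (λ e → trans (sym (ℕP.m∸n+n≡m p≤k)) (cong (ℕ._+ p) e))
                                             (λ e → trans (cong (_∸ p) e) (ℕP.m+n∸n≡m mb p)) ⟩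
      δ k (mb ℕ.+ p)               ≡⟨ sym (ℤP.+-identityˡ _) ⟩
      + 0 + δ k (mb ℕ.+ p)         ≡⟨ cong (_+ δ k (mb ℕ.+ p)) (sym (δ-≢ (λ k≡mb → ℕP.<-irrefl (sym k≡mb) (ℕP.<-≤-trans mb<p p≤k)))) ⟩
      δ k mb + δ k (mb ℕ.+ p)      ∎
    where
    open ≡-Reasoning
    p≤k : p ≤ k
    p≤k = ℕP.≮⇒≥ k≮p
    k-p<p : k ∸ p < p
    k-p<p = ℕP.+-cancelʳ-< p (k ∸ p) p (subst (_< p ℕ.+ p) (sym (ℕP.m∸n+n≡m p≤k))
              (subst (k <_) (cong (p ℕ.+_) (ℕP.+-identityʳ p)) k<2p))

  B-middle : sgn p ≡ -1ℤ → ∀ n mb → mb < p → n < 2 ℕ.* p →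
    B n mb ≡ sgn mb * + (n C mb) - sgn mb * + (n C (mb ℕ.+ p))
  B-middle sgn-p n mb mb<p n<2p = begin
      B n mb
        ≡⟨ T-cong n (λ k k≤n → δ-mod-two-periods k mb mb<p (ℕP.≤-<-trans k≤n n<2p)) ⟩
      T n (λ k → δ k mb + δ k (mb ℕ.+ p))
        ≡⟨ trans (T-+ n _ _) (cong₂ _+_ (T-δ n mb) (T-δ n (mb ℕ.+ p))) ⟩
      sgn mb * + (n C mb) + sgn (mb ℕ.+ p) * + (n C (mb ℕ.+ p))
        ≡⟨ cong (λ s → sgn mb * + (n C mb) + s * + (n C (mb ℕ.+ p)))
             (trans (ℤP.^-distribˡ-+-* -1ℤ mb p) (cong (sgn mb *_) sgn-p)) ⟩
      sgn mb * + (n C mb) + sgn mb * -1ℤ * + (n C (mb ℕ.+ p))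
        ≡⟨ alg (sgn mb) _ _ ⟩
      sgn mb * + (n C mb) - sgn mb * + (n C (mb ℕ.+ p)) ∎
    where
    open ≡-Reasoning
    alg : ∀ s a b → s * a + s * -1ℤ * b ≡ s * a - s * b
    alg = solve-∀

-- 5. Fleck's congruence

prime∤factorial : ∀ {p} → Prime p → ∀ t → t < p → ¬ (p ℕD.∣ t !)
prime∤factorial {p} pr zero    _   = ℕD.>⇒∤ (ℕ.nonTrivial⇒n>1 p {{prime⇒nonTrivial pr}})
prime∤factorial {p} pr (suc t) t<p p∣t! with euclidsLemma (suc t) (t !) pr p∣t!
... | inj₁ p∣1+t = ℕD.>⇒∤ t<p p∣1+t
... | inj₂ p∣t!  = prime∤factorial pr t (ℕP.<-trans (ℕP.n<1+n t) t<p) p∣t!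

prime∣binomial : ∀ {p} → Prime p → ∀ s → 0 < s → s < p → p ℕD.∣ p C s
prime∣binomial {p} pr s 0<s s<p with euclidsLemma (p C s) (s ! ℕ.* (p ∸ s) !) pr p∣product
  where
  instance _ = s ℕP.!* (p ∸ s) !≢0
  n∣n! : ∀ n → 0 < n → n ℕD.∣ n !
  n∣n! (suc n) _ = ℕD.m∣m*n (n !)
  p∣product : p ℕD.∣ (p C s) ℕ.* (s ! ℕ.* (p ∸ s) !)
  p∣product = subst (p ℕD.∣_)
    (sym (trans (cong (ℕ._* (s ! ℕ.* (p ∸ s) !)) (nCk≡n!/k![n-k]! (ℕP.<⇒≤ s<p))) (m/n*n≡m (k![n∸k]!∣n! (ℕP.<⇒≤ s<p)))))
    (n∣n! p (ℕP.<-trans 0<s s<p))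
... | inj₁ p∣C = p∣C
... | inj₂ p∣s!*[p-s]! with euclidsLemma (s !) ((p ∸ s) !) pr p∣s!*[p-s]!
...   | inj₁ p∣s!     = ⊥-elim (prime∤factorial pr s s<p p∣s!)
...   | inj₂ p∣[p-s]! = ⊥-elim (prime∤factorial pr (p ∸ s) (ℕP.∸-monoʳ-< {p} {s} {0} 0<s (ℕP.<⇒≤ s<p)) p∣[p-s]!)

-- (−1)^l C(p−1,l) ≡ 1 (mod p) for l < p, by induction on l using
-- C(p−1,l) + C(p−1,l+1) = C(p,l+1) ≡ 0.
signed-binomial≡1 : ∀ {p} → Prime p → ∀ l → l < p → + p ℤS.∣ sgn l * + ((p ∸ 1) C l) - + 1
signed-binomial≡1 {p} pr zero    _     = ℤS.divides (+ 0) (sym (ℤP.*-zeroˡ (+ p)))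
signed-binomial≡1 {p} pr (suc l) 1+l<p = subst (+ p ℤS.∣_) (sym recurrence)
  (ℤS.∣m∣n⇒∣m-n (signed-binomial≡1 pr l (ℕP.<-trans (ℕP.n<1+n l) 1+l<p))
    (ℤS.∣n⇒∣m*n (sgn l) (ℤS.∣ᵤ⇒∣ (subst (λ q → p ℕD.∣ q C suc l) (sym (ℕP.suc-pred p))
      (prime∣binomial pr (suc l) (s≤s z≤n) 1+l<p)))))
  where
  instance _ = prime⇒nonZero pr
  a = (p ∸ 1) C l
  b = (p ∸ 1) C suc l
  alg : ∀ s a b → -1ℤ * s * b - + 1 ≡ (s * a - + 1) - s * (a + b)
  alg = solve-∀
  recurrence : sgn (suc l) * + b - + 1 ≡ (sgn l * + a - + 1) - sgn l * + (suc (p ∸ 1) C suc l)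
  recurrence = trans (alg (sgn l) (+ a) (+ b)) (cong (λ z → (sgn l * + a - + 1) - sgn l * z)
    (trans (sym (ℤP.pos-+ a b)) (cong +_ (nCk+nC[k+1]≡[n+1]C[k+1] (p ∸ 1) l))))

-- One round of p − 1 differences gains a factor p: if p^t divides every
-- h l (l < p) and Σ_{l<p} h l = 0, then p^{t+1} ∣ T (p−1) h, because
-- T (p−1) h = Σ_l h l · (−1)^l C(p−1,l) = Σ_l h l · ((−1)^l C(p−1,l) − 1).
fleck-step : ∀ {p} → Prime p → ∀ t (h : ℕ → ℤ) → (∀ l → l < p → + (p ℕ.^ t) ℤS.∣ h l) → ∑ p h ≡ + 0 →
  + (p ℕ.^ suc t) ℤS.∣ T (p ∸ 1) h
fleck-step {p} pr t h pᵗ∣h Σh≡0 = subst (+ (p ℕ.^ suc t) ℤS.∣_) (sym T≡Σ)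
  (∑-∣ p _ _ (λ l l<p → ℤS.∣ᵤ⇒∣ (subst₂ ℕD._∣_ (ℕP.*-comm (p ℕ.^ t) p)
    (sym (trans (cong ℤ.∣_∣ (alg (h l) (e l))) (ℤP.abs-* (h l) (e l - + 1))))
    (ℕD.*-pres-∣ (ℤS.∣⇒∣ᵤ (pᵗ∣h l l<p)) (ℤS.∣⇒∣ᵤ (signed-binomial≡1 pr l l<p))))))
  where
  instance _ = prime⇒nonZero pr
  e : ℕ → ℤ
  e l = sgn l * + ((p ∸ 1) C l)
  alg : ∀ h e → h * e - h ≡ h * (e - + 1)
  alg = solve-∀
  open ≡-Reasoning
  T≡Σ : T (p ∸ 1) h ≡ ∑ p (λ l → h l * e l - h l)
  T≡Σ = begin
    T (p ∸ 1) h                                ≡⟨ T-expand (p ∸ 1) h ⟩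
    ∑ (suc (p ∸ 1)) (λ l → h l * e l)          ≡⟨ cong (λ q → ∑ q (λ l → h l * e l)) (ℕP.suc-pred p) ⟩
    ∑ p (λ l → h l * e l)                      ≡⟨ sym (ℤP.+-identityʳ _) ⟩
    ∑ p (λ l → h l * e l) - + 0                ≡⟨ cong (_-_ (∑ p (λ l → h l * e l))) (sym Σh≡0) ⟩
    ∑ p (λ l → h l * e l) - ∑ p h              ≡⟨ sym (∑-- p (λ l → h l * e l) h) ⟩
    ∑ p (λ l → h l * e l - h l)                ∎

module Fleck (p : ℕ) .{{_ : NonZero p}} where
  open Mod p
  open Model p

  -- σ m ≡ m − 1 (mod p).
  σ : ℕ → ℕ
  σ m = (m ℕ.+ neg 1) % p

  B-step : ∀ n m → m < p → B (suc n) m ≡ B n m - B n (σ m)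
  B-step n m m<p = cong (_-_ (B n m)) (T-cong n (λ k _ → begin
      δ (suc k % p) m                  ≡⟨ δ-sym (suc k % p) m ⟩
      δ m ((1 ℕ.+ k) % p)              ≡⟨ cong (λ z → δ m (z % p)) (ℕP.+-comm 1 k) ⟩
      δ m ((k ℕ.+ 1) % p)              ≡⟨ shift-δ k 1 m m<p ⟩
      δ ((m ℕ.+ neg 1) % p) (k % p)    ≡⟨ δ-sym _ (k % p) ⟩
      δ (k % p) (σ m)                  ∎))
    where open ≡-Reasoning

  orbit : ℕ → ℕ → ℕ
  orbit m l = iterate σ m l

  orbit-< : ∀ l m → m < p → orbit m l < p
  orbit-< zero    m m<p = m<p
  orbit-< (suc l) m _   = orbit-< l (σ m) (m%n<n _ p)

  orbit-suc : ∀ l m → σ (orbit m l) ≡ orbit (σ m) l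
  orbit-suc zero    m = refl
  orbit-suc (suc l) m = orbit-suc l (σ m)

  orbit-closed : ∀ l m → m < p → orbit m l ≡ (m ℕ.+ l ℕ.* neg 1) % p
  orbit-closed zero    m m<p = sym (trans (cong (_% p) (ℕP.+-identityʳ m)) (m<n⇒m%n≡m m<p))
  orbit-closed (suc l) m m<p = trans (orbit-closed l (σ m) (m%n<n _ p))
    (trans (%-absorbˡ (m ℕ.+ neg 1) (l ℕ.* neg 1)) (cong (_% p) (ℕP.+-assoc m (neg 1) (l ℕ.* neg 1))))

  orbit-period : ∀ m → m < p → orbit m p ≡ m
  orbit-period m m<p = trans (orbit-closed p m m<p)
    (trans (cong (λ z → (m ℕ.+ z) % p) (ℕP.*-comm p (neg 1)))
      (trans ([m+kn]%n≡m%n m (neg 1) p) (m<n⇒m%n≡m m<p)))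

  B-iterate : ∀ j n m → m < p → B (n ℕ.+ j) m ≡ T j (λ l → B n (orbit m l))
  B-iterate zero    n m m<p = cong (λ z → B z m) (ℕP.+-identityʳ n)
  B-iterate (suc j) n m m<p = trans (cong (λ z → B z m) (ℕP.+-suc n j))
    (trans (B-step (n ℕ.+ j) m m<p) (cong₂ _-_ (B-iterate j n m m<p) (B-iterate j n (σ m) (m%n<n _ p))))

  -- Summing the difference equation over an orbit telescopes to 0.
  B-orbit-sum : ∀ n m → m < p → ∑ p (λ l → B (suc n) (orbit m l)) ≡ + 0
  B-orbit-sum n m m<p = begin
      ∑ p (λ l → B (suc n) (orbit m l))
        ≡⟨ ∑-cong p (λ l _ → trans (B-step n _ (orbit-< l m m<p)) (cong (λ r → B n (orbit m l) - B n r) (orbit-suc l m))) ⟩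
      ∑ p (λ l → B n (orbit m l) - B n (orbit m (suc l)))
        ≡⟨ ∑-telescope p (λ l → B n (orbit m l)) ⟩
      B n m - B n (orbit m p)
        ≡⟨ cong (λ r → B n m - B n r) (orbit-period m m<p) ⟩
      B n m - B n m
        ≡⟨ ℤP.+-inverseʳ (B n m) ⟩
      + 0 ∎
    where open ≡-Reasoning

  fleck : Prime p → ∀ t s m → m < p → + (p ℕ.^ t) ℤS.∣ B (suc s ℕ.+ t ℕ.* (p ∸ 1)) m
  fleck pr zero    s m m<p = ℤS.divides (B (suc s ℕ.+ 0) m) (sym (ℤP.*-identityʳ _))
  fleck pr (suc t) s m m<p = subst (+ (p ℕ.^ suc t) ℤS.∣_)
    (sym (trans (cong (λ z → B z m) reassoc) (B-iterate (p ∸ 1) n₀ m m<p)))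
    (fleck-step pr t (λ l → B n₀ (orbit m l)) (λ l l<p → fleck pr t s (orbit m l) (orbit-< l m m<p))
      (B-orbit-sum (s ℕ.+ t ℕ.* (p ∸ 1)) m m<p))
    where
    n₀ = suc s ℕ.+ t ℕ.* (p ∸ 1)
    reassoc : suc s ℕ.+ suc t ℕ.* (p ∸ 1) ≡ n₀ ℕ.+ (p ∸ 1)
    reassoc = alg (suc s) t (p ∸ 1)
      where
      alg : ∀ s t x → s ℕ.+ (x ℕ.+ t ℕ.* x) ≡ s ℕ.+ t ℕ.* x ℕ.+ x
      alg = ℕS.solve-∀

^-∣-^ : ∀ a {j q} → j ≤ q → a ℕ.^ j ℕD.∣ a ℕ.^ q
^-∣-^ a {j} {q} j≤q = subst (a ℕ.^ j ℕD.∣_)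
  (trans (sym (ℕP.^-distribˡ-+-* a j (q ∸ j))) (cong (a ℕ.^_) (ℕP.m+[n∸m]≡n j≤q)))
  (ℕD.m∣m*n (a ℕ.^ (q ∸ j)))

module Divisibility (p : ℕ) (pr : Prime p) where
  instance
    p-nonZero : NonZero p
    p-nonZero = prime⇒nonZero pr
    p-1-nonZero : NonZero (p ∸ 1)
    p-1-nonZero = prime⇒pred-nonZero pr
  open Model p
  open Fleck p

  -- p^{⌊(n−1)/(p−1)⌋} ∣ B n m̄ for n = n' + 1 ≥ 1: Fleck's congruence with
  -- n' = s + t(p−1), s = n' mod (p−1).
  B-divisible : ∀ n' mb → mb < p → + (p ℕ.^ (n' / (p ∸ 1))) ℤS.∣ B (suc n') mb
  B-divisible n' mb mb<p = subst (λ z → + (p ℕ.^ (n' / (p ∸ 1))) ℤS.∣ B (suc z) mb)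
    (sym (m≡m%n+[m/n]*n n' (p ∸ 1)))
    (fleck pr (n' / (p ∸ 1)) (n' % (p ∸ 1)) mb mb<p)

  floor-shift : ∀ n' → (suc n' ℕ.+ p ∸ 2) / (p ∸ 1) ∸ 1 ≡ n' / (p ∸ 1)
  floor-shift n' = trans (cong (λ z → z / (p ∸ 1) ∸ 1) numerator)
    (cong (_∸ 1) (trans (m/n≡1+[m∸n]/n (ℕP.m≤n+m (p ∸ 1) n'))
      (cong (λ z → suc (z / (p ∸ 1))) (ℕP.m+n∸n≡m n' (p ∸ 1)))))
    where
    numerator : suc n' ℕ.+ p ∸ 2 ≡ n' ℕ.+ (p ∸ 1)
    numerator = cong (_∸ 2) (trans (cong (suc n' ℕ.+_) (sym (ℕP.suc-pred p))) (cong suc (ℕP.+-suc n' (p ∸ 1))))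

  below-floor : ∀ j n' → j ℕ.* (p ∸ 1) < suc n' → j ≤ n' / (p ∸ 1)
  below-floor j n' lt = subst (_≤ n' / (p ∸ 1)) (m*n/n≡m j (p ∸ 1)) (/-monoˡ-≤ (p ∸ 1) (ℕP.≤-pred lt))

lemma6p2 : (p : ℕ) (pr : Prime p) → p ≢ 2 →
    (m : ℚ) → ¬ (p ℕD.∣ (↧ₙ m)) →
    (mb : ℕ) → mb < p → (+ p) ℤD.∣ ((↥ m) ℤ.- (+ mb) ℤ.* (↧ m)) →
    (n : ℕ) →
    Σ ℤ (λ b →
      _≈_ p {{prime⇒nonZero pr}} (rootSum p {{prime⇒nonZero pr}} mb n)
        (const p {{prime⇒nonZero pr}} ((+ p) ℤ.* b))
      × (n < p → b ≡ (-1ℤ ℤ.^ mb) ℤ.* (+ (n C mb)))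
      × (p ≤ n → n < 2 ℕ.* p →
          b ≡ (-1ℤ ℤ.^ mb) ℤ.* (+ (n C mb)) ℤ.- (-1ℤ ℤ.^ mb) ℤ.* (+ (n C (mb ℕ.+ p))))
      × (1 ≤ n →
          (+ (p ℕ.^ (_/_ (n ℕ.+ p ∸ 2) (p ∸ 1) {{prime⇒pred-nonZero pr}} ∸ 1))) ℤD.∣ b)
      × ((j : ℕ) → j ℕ.* (p ∸ 1) < n → n ≤ (j ℕ.+ 1) ℕ.* (p ∸ 1) → (+ (p ℕ.^ j)) ℤD.∣ b))
lemma6p2 p pr p≢2 _ _ mb mb<p _ n =
  B n mb ,
  (_ , rootSum-formula pr mb n mb<p) ,
  B-small n mb ,
  (λ _ → B-middle (sgn-odd-prime pr p≢2) n mb mb<p) ,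
  floor-divides n ,
  (λ j j[p-1]<n _ → power-divides n j j[p-1]<n)
  where
  open Divisibility p pr
  open Model p
  open ClosedForms p

  floor-divides : ∀ n → 1 ≤ n → + (p ℕ.^ ((n ℕ.+ p ∸ 2) / (p ∸ 1) ∸ 1)) ℤD.∣ B n mb
  floor-divides (suc n') _ = subst (λ e → + (p ℕ.^ e) ℤD.∣ B (suc n') mb) (sym (floor-shift n'))
    (ℤS.∣⇒∣ᵤ (B-divisible n' mb mb<p))

  power-divides : ∀ n j → j ℕ.* (p ∸ 1) < n → + (p ℕ.^ j) ℤD.∣ B n mb
  power-divides (suc n') j lt = ℕD.∣-trans (^-∣-^ p (below-floor j n' lt)) (ℤS.∣⇒∣ᵤ (B-divisible n' mb mb<p))
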